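{- Let $\mathcal{C}$ be a Kleene rig category. For all $a\colon X\to X$ and $b\colon Y\to Y$, $(a\otimes b)^*\le a^*\otimes b^*$.
   Context: Composition is diagrammatic. A rig category has two symmetric monoidal structures $(\otimes,1)$, $(\oplus,0)$ with natural distributors and annihilators satisfying Laplaza's coherence axioms. A Kleene rig category is a poset-enriched rig category (homsets are posets and $;$, $\oplus$, $\otimes$ are monotone) such that $(\mathcal{C},\oplus,0)$ is a Kleene bicategory, i.e.: it has finite biproducts given by monoids $(\nabla_X\colon X\oplus X\to X,¡_X\colon 0\to X)$ and comonoids $(\Delta_X\colon X\to X\oplus X,!_X\colon X\to0)$ of which every morphism is a homomorphism; $\mathrm{id}_{X\oplus X}\le\nabla_X;\Delta_X$, $\Delta_X;\nabla_X\le\mathrm{id}_X$, $\mathrm{id}_0\le¡_X;!_X$, $!_X;¡_X\le\mathrm{id}_X$; and there is a trace $\mathsf{tr}_S\colon\mathcal{C}(S\oplus X,S\oplus Y)\to\mathcal{C}(X,Y)$ (tightening, strength, joining, vanishing, sliding, yanking) satisfying (AU1) $f;(r\oplus\mathrm{id})\le(r\oplus\mathrm{id});g$ with $r\colon S\to T$ implies $\mathsf{tr}_Sf\le\mathsf{tr}_Tg$, (AU2) $(r\oplus\mathrm{id});f\le g;(r\oplus\mathrm{id})$ with $r\colon T\to S$ implies $\mathsf{tr}_Sf\le\mathsf{tr}_Tg$, and (AT1) $\mathsf{tr}_X(\nabla_X;\Delta_X)\le\mathrm{id}_X$. The Kleene star is $f^*:=\mathsf{tr}_X(\nabla_X;\Delta_X;(f\oplus\mathrm{id}_X))$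 for $f\colon X\to X$. -}

module Defs where

open import Level using (Level; _⊔_; suc)
open import Data.Product using (_×_)
open import Relation.Binary.Core using (Rel)

-- Conventions
--  * Composition is diagrammatic:  f ⨾ g  means "first f, then g".
--  * Homsets are posets: _≤_ is a preorder on each homset and equality
--    of morphisms is the induced (antisymmetric) equality
--    f ≈ g  :=  f ≤ g  ×  g ≤ f .

module _ {o ℓ r : Level} {Obj : Set o} (_⇒_ : Obj → Obj → Set ℓ)
         (_≤_ : ∀ {X Y} → Rel (X ⇒ Y) r) where

  Eq : ∀ {X Y} → Rel (X ⇒ Y) r
  Eq f g = f ≤ g × g ≤ f

record SymMonStr {o ℓ r : Level} (Obj : Set o) (_⇒_ : Obj → Obj → Set ℓ)
                 (_≤_ : ∀ {X Y} → Rel (X ⇒ Y) r)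
                 (_⨾_ : ∀ {X Y Z} → X ⇒ Y → Y ⇒ Z → X ⇒ Z)
                 (id : ∀ {X} → X ⇒ X) : Set (o ⊔ ℓ ⊔ r) where
  infixr 10 _∙₀_ _∙₁_
  infix 4 _≈_
  private
    _≈_ : ∀ {X Y} → Rel (X ⇒ Y) r
    _≈_ = Eq _⇒_ _≤_
  field
    _∙₀_ : Obj → Obj → Obj
    _∙₁_ : ∀ {X Y Z W} → X ⇒ Y → Z ⇒ W → (X ∙₀ Z) ⇒ (Y ∙₀ W)
    unit : Obj

    ∙-id   : ∀ {X Y} → (id {X} ∙₁ id {Y}) ≈ id
    ∙-comp : ∀ {X Y Z X' Y' Z'} (f : X ⇒ Y) (g : Y ⇒ Z) (h : X' ⇒ Y') (k : Y' ⇒ Z') →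
             ((f ∙₁ h) ⨾ (g ∙₁ k)) ≈ ((f ⨾ g) ∙₁ (h ⨾ k))
    ∙-mono : ∀ {X Y Z W} {f f' : X ⇒ Y} {g g' : Z ⇒ W} → f ≤ f' → g ≤ g' → (f ∙₁ g) ≤ (f' ∙₁ g')

    assoc    : ∀ {X Y Z} → (X ∙₀ (Y ∙₀ Z)) ⇒ ((X ∙₀ Y) ∙₀ Z)
    assoc⁻¹  : ∀ {X Y Z} → ((X ∙₀ Y) ∙₀ Z) ⇒ (X ∙₀ (Y ∙₀ Z))
    lunit    : ∀ {X} → (unit ∙₀ X) ⇒ X
    lunit⁻¹  : ∀ {X} → X ⇒ (unit ∙₀ X)
    runit    : ∀ {X} → (X ∙₀ unit) ⇒ X
    runit⁻¹  : ∀ {X} → X ⇒ (X ∙₀ unit)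
    sym      : ∀ {X Y} → (X ∙₀ Y) ⇒ (Y ∙₀ X)

    assoc-iso₁ : ∀ {X Y Z} → (assoc {X} {Y} {Z} ⨾ assoc⁻¹) ≈ id
    assoc-iso₂ : ∀ {X Y Z} → (assoc⁻¹ {X} {Y} {Z} ⨾ assoc) ≈ id
    lunit-iso₁ : ∀ {X} → (lunit {X} ⨾ lunit⁻¹) ≈ id
    lunit-iso₂ : ∀ {X} → (lunit⁻¹ {X} ⨾ lunit) ≈ id
    runit-iso₁ : ∀ {X} → (runit {X} ⨾ runit⁻¹) ≈ id
    runit-iso₂ : ∀ {X} → (runit⁻¹ {X} ⨾ runit) ≈ id
    sym-invol  : ∀ {X Y} → (sym {X} {Y} ⨾ sym) ≈ id

    assoc-nat : ∀ {X Y Z X' Y' Z'} (f : X ⇒ X') (g : Y ⇒ Y') (h : Z ⇒ Z') →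
                ((f ∙₁ (g ∙₁ h)) ⨾ assoc) ≈ (assoc ⨾ ((f ∙₁ g) ∙₁ h))
    lunit-nat : ∀ {X Y} (f : X ⇒ Y) → ((id {unit} ∙₁ f) ⨾ lunit) ≈ (lunit ⨾ f)
    runit-nat : ∀ {X Y} (f : X ⇒ Y) → ((f ∙₁ id {unit}) ⨾ runit) ≈ (runit ⨾ f)
    sym-nat   : ∀ {X Y X' Y'} (f : X ⇒ X') (g : Y ⇒ Y') →
                ((f ∙₁ g) ⨾ sym) ≈ (sym ⨾ (g ∙₁ f))

    pentagon : ∀ {W X Y Z} →
               (assoc {W} {X} {Y ∙₀ Z} ⨾ assoc) ≈
               ((id ∙₁ assoc) ⨾ (assoc ⨾ (assoc ∙₁ id)))
    triangle : ∀ {X Y} →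
               (assoc {X} {unit} {Y} ⨾ (runit ∙₁ id)) ≈ (id ∙₁ lunit)
    hexagon  : ∀ {X Y Z} →
               (assoc {X} {Y} {Z} ⨾ (sym ⨾ assoc)) ≈
               ((id ∙₁ sym) ⨾ (assoc ⨾ (sym ∙₁ id)))

record KleeneRigCategory (o ℓ r : Level) : Set (suc (o ⊔ ℓ ⊔ r)) where
  infixr 9 _⨾_
  infix 4 _≤_ _≈_
  field
    Obj  : Set o
    _⇒_  : Obj → Obj → Set ℓ
    _≤_  : ∀ {X Y} → Rel (X ⇒ Y) r
    _⨾_  : ∀ {X Y Z} → X ⇒ Y → Y ⇒ Z → X ⇒ Z
    id   : ∀ {X} → X ⇒ X

    ≤-refl  : ∀ {X Y} {f : X ⇒ Y} → f ≤ f
    ≤-trans : ∀ {X Y} {f g h : X ⇒ Y} → f ≤ g → g ≤ h → f ≤ h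

  _≈_ : ∀ {X Y} → Rel (X ⇒ Y) r
  _≈_ = Eq _⇒_ _≤_

  field
    idˡ    : ∀ {X Y} (f : X ⇒ Y) → (id ⨾ f) ≈ f
    idʳ    : ∀ {X Y} (f : X ⇒ Y) → (f ⨾ id) ≈ f
    ⨾-assoc : ∀ {X Y Z W} (f : X ⇒ Y) (g : Y ⇒ Z) (h : Z ⇒ W) → ((f ⨾ g) ⨾ h) ≈ (f ⨾ (g ⨾ h))
    ⨾-mono : ∀ {X Y Z} {f f' : X ⇒ Y} {g g' : Y ⇒ Z} → f ≤ f' → g ≤ g' → (f ⨾ g) ≤ (f' ⨾ g')

    ⊗-str : SymMonStr Obj _⇒_ _≤_ _⨾_ id
    ⊕-str : SymMonStr Obj _⇒_ _≤_ _⨾_ id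

  open SymMonStr ⊗-str public using ()
    renaming ( _∙₀_ to _⊗₀_ ; _∙₁_ to _⊗₁_ ; unit to 𝟙
             ; assoc to α⊗ ; assoc⁻¹ to α⊗⁻¹ ; lunit to λ⊗ ; lunit⁻¹ to λ⊗⁻¹
             ; runit to ρ⊗ ; runit⁻¹ to ρ⊗⁻¹ ; sym to σ⊗ )
  open SymMonStr ⊕-str public using ()
    renaming ( _∙₀_ to _⊕₀_ ; _∙₁_ to _⊕₁_ ; unit to 𝟘
             ; assoc to α⊕ ; assoc⁻¹ to α⊕⁻¹ ; lunit to λ⊕ ; lunit⁻¹ to λ⊕⁻¹
             ; runit to ρ⊕ ; runit⁻¹ to ρ⊕⁻¹ ; sym to σ⊕ )

  mid⊕ : ∀ {P Q R S} → ((P ⊕₀ Q) ⊕₀ (R ⊕₀ S)) ⇒ ((P ⊕₀ R) ⊕₀ (Q ⊕₀ S))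
  mid⊕ = α⊕ ⨾ ((α⊕⁻¹ ⊕₁ id) ⨾ (((id ⊕₁ σ⊕) ⊕₁ id) ⨾ ((α⊕ ⊕₁ id) ⨾ α⊕⁻¹)))

  field
    δˡ   : ∀ {A B C} → (A ⊗₀ (B ⊕₀ C)) ⇒ ((A ⊗₀ B) ⊕₀ (A ⊗₀ C))
    δˡ⁻¹ : ∀ {A B C} → ((A ⊗₀ B) ⊕₀ (A ⊗₀ C)) ⇒ (A ⊗₀ (B ⊕₀ C))
    δʳ   : ∀ {A B C} → ((A ⊕₀ B) ⊗₀ C) ⇒ ((A ⊗₀ C) ⊕₀ (B ⊗₀ C))
    δʳ⁻¹ : ∀ {A B C} → ((A ⊗₀ C) ⊕₀ (B ⊗₀ C)) ⇒ ((A ⊕₀ B) ⊗₀ C)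
    λ•   : ∀ {A} → (𝟘 ⊗₀ A) ⇒ 𝟘
    λ•⁻¹ : ∀ {A} → 𝟘 ⇒ (𝟘 ⊗₀ A)
    ρ•   : ∀ {A} → (A ⊗₀ 𝟘) ⇒ 𝟘
    ρ•⁻¹ : ∀ {A} → 𝟘 ⇒ (A ⊗₀ 𝟘)

    δˡ-iso₁ : ∀ {A B C} → (δˡ {A} {B} {C} ⨾ δˡ⁻¹) ≈ id
    δˡ-iso₂ : ∀ {A B C} → (δˡ⁻¹ {A} {B} {C} ⨾ δˡ) ≈ id
    δʳ-iso₁ : ∀ {A B C} → (δʳ {A} {B} {C} ⨾ δʳ⁻¹) ≈ id
    δʳ-iso₂ : ∀ {A B C} → (δʳ⁻¹ {A} {B} {C} ⨾ δʳ) ≈ id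
    λ•-iso₁ : ∀ {A} → (λ• {A} ⨾ λ•⁻¹) ≈ id
    λ•-iso₂ : ∀ {A} → (λ•⁻¹ {A} ⨾ λ•) ≈ id
    ρ•-iso₁ : ∀ {A} → (ρ• {A} ⨾ ρ•⁻¹) ≈ id
    ρ•-iso₂ : ∀ {A} → (ρ•⁻¹ {A} ⨾ ρ•) ≈ id

    δˡ-nat : ∀ {A B C A' B' C'} (f : A ⇒ A') (g : B ⇒ B') (h : C ⇒ C') →
             ((f ⊗₁ (g ⊕₁ h)) ⨾ δˡ) ≈ (δˡ ⨾ ((f ⊗₁ g) ⊕₁ (f ⊗₁ h)))
    δʳ-nat : ∀ {A B C A' B' C'} (f : A ⇒ A') (g : B ⇒ B') (h : C ⇒ C') →
             (((f ⊕₁ g) ⊗₁ h) ⨾ δʳ) ≈ (δʳ ⨾ ((f ⊗₁ h) ⊕₁ (g ⊗₁ h)))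
    λ•-nat : ∀ {A B} (f : A ⇒ B) → ((id {𝟘} ⊗₁ f) ⨾ λ•) ≈ λ•
    ρ•-nat : ∀ {A B} (f : A ⇒ B) → ((f ⊗₁ id {𝟘}) ⨾ ρ•) ≈ ρ•

    -- Laplaza's coherence axioms (I)–(XXIV)
    L-I    : ∀ {A B C} → (δˡ {A} {B} {C} ⨾ (σ⊗ ⊕₁ σ⊗)) ≈ (σ⊗ ⨾ δʳ)
    L-II   : ∀ {A B C} → (δʳ {A} {B} {C} ⨾ σ⊕) ≈ ((σ⊕ ⊗₁ id) ⨾ δʳ)
    L-III  : ∀ {A B C} → (δˡ {A} {B} {C} ⨾ σ⊕) ≈ ((id ⊗₁ σ⊕) ⨾ δˡ)
    L-IV   : ∀ {A B C D} →
             (δʳ {A} {B ⊕₀ C} {D} ⨾ ((id ⊕₁ δʳ) ⨾ α⊕)) ≈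
             ((α⊕ ⊗₁ id) ⨾ (δʳ ⨾ (δʳ ⊕₁ id)))
    L-V    : ∀ {A B C D} →
             ((id {A} ⊗₁ δˡ {B} {C} {D}) ⨾ (δˡ ⨾ (α⊗ ⊕₁ α⊗))) ≈ (α⊗ ⨾ δˡ)
    L-VI   : ∀ {A B C D} →
             ((id {A} ⊗₁ δʳ {B} {C} {D}) ⨾ (δˡ ⨾ (α⊗ ⊕₁ α⊗))) ≈
             (α⊗ ⨾ ((δˡ ⊗₁ id) ⨾ δʳ))
    L-VII  : ∀ {A B C D} →
             (δʳ {A} {B} {C ⊗₀ D} ⨾ (α⊗ ⊕₁ α⊗)) ≈ (α⊗ ⨾ ((δʳ ⊗₁ id) ⨾ δʳ))
    L-VIII : ∀ {A B C D} →
             ((id {A} ⊗₁ α⊕ {B} {C} {D}) ⨾ (δˡ ⨾ (δˡ ⊕₁ id))) ≈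
             (δˡ ⨾ ((id ⊕₁ δˡ) ⨾ α⊕))
    L-IX   : ∀ {A B C D} →
             (δʳ {A} {B} {C ⊕₀ D} ⨾ (δˡ ⊕₁ δˡ)) ≈ (δˡ ⨾ ((δʳ ⊕₁ δʳ) ⨾ mid⊕))
    L-X    : (λ• {𝟘}) ≈ ρ• {𝟘}
    L-XI   : ∀ {A B} → (α⊗ {𝟘} {A} {B} ⨾ ((λ• ⊗₁ id) ⨾ λ•)) ≈ λ•
    L-XII  : ∀ {A B} → (α⊗ {A} {B} {𝟘} ⨾ ρ•) ≈ ((id ⊗₁ ρ•) ⨾ ρ•)
    L-XIII : ∀ {A B} → (α⊗ {A} {𝟘} {B} ⨾ ((ρ• ⊗₁ id) ⨾ λ•)) ≈ ((id ⊗₁ λ•) ⨾ ρ•)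
    L-XIV  : ∀ {A B} → (δˡ {A} {𝟘} {B} ⨾ ((ρ• ⊕₁ id) ⨾ λ⊕)) ≈ (id ⊗₁ λ⊕)
    L-XV   : ∀ {A B} → (δʳ {𝟘} {A} {B} ⨾ ((λ• ⊕₁ id) ⨾ λ⊕)) ≈ (λ⊕ ⊗₁ id)
    L-XVI  : ∀ {A B} → (δˡ {A} {B} {𝟘} ⨾ ((id ⊕₁ ρ•) ⨾ ρ⊕)) ≈ (id ⊗₁ ρ⊕)
    L-XVII : ∀ {A B} → (δʳ {A} {𝟘} {B} ⨾ ((id ⊕₁ λ•) ⨾ ρ⊕)) ≈ (ρ⊕ ⊗₁ id)
    L-XVIII : λ• {𝟙} ≈ ρ⊗ {𝟘}
    L-XIX  : ρ• {𝟙} ≈ λ⊗ {𝟘}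
    L-XX   : ∀ {A} → ρ• {A} ≈ (σ⊗ ⨾ λ•)
    L-XXI  : ∀ {A B} → λ⊗ {A ⊕₀ B} ≈ (δˡ ⨾ (λ⊗ ⊕₁ λ⊗))
    L-XXII : ∀ {A B} → ρ⊗ {A ⊕₀ B} ≈ (δʳ ⨾ (ρ⊗ ⊕₁ ρ⊗))
    L-XXIII : ∀ {A B} → ρ• {A ⊕₀ B} ≈ (δʳ ⨾ ((ρ• ⊕₁ ρ•) ⨾ λ⊕))
    L-XXIV : ∀ {A B} → λ• {A ⊕₀ B} ≈ (δˡ ⨾ ((λ• ⊕₁ λ•) ⨾ λ⊕))

    -- (C, ⊕, 0) is a Kleene bicategory
    -- biproducts given by commutative monoids (∇, ¡) and commutative
    -- comonoids (Δ, !), compatible with ⊕, of which every morphism is a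
    -- homomorphism
    ∇ : ∀ {X} → (X ⊕₀ X) ⇒ X
    ¡ : ∀ {X} → 𝟘 ⇒ X
    Δ : ∀ {X} → X ⇒ (X ⊕₀ X)
    ! : ∀ {X} → X ⇒ 𝟘

    ∇-assoc : ∀ {X} → (α⊕ ⨾ ((∇ ⊕₁ id) ⨾ ∇)) ≈ ((id ⊕₁ ∇) ⨾ ∇ {X})
    ∇-unit  : ∀ {X} → (λ⊕⁻¹ ⨾ ((¡ ⊕₁ id) ⨾ ∇)) ≈ id {X}
    ∇-comm  : ∀ {X} → (σ⊕ ⨾ ∇) ≈ ∇ {X}
    Δ-assoc : ∀ {X} → (Δ ⨾ (Δ ⊕₁ id)) ≈ (Δ {X} ⨾ ((id ⊕₁ Δ) ⨾ α⊕))
    Δ-unit  : ∀ {X} → (Δ ⨾ ((! ⊕₁ id) ⨾ λ⊕)) ≈ id {X}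
    Δ-comm  : ∀ {X} → (Δ ⨾ σ⊕) ≈ Δ {X}

    ∇-uniform : ∀ {X Y} → ∇ {X ⊕₀ Y} ≈ (mid⊕ ⨾ (∇ ⊕₁ ∇))
    ¡-uniform : ∀ {X Y} → ¡ {X ⊕₀ Y} ≈ (λ⊕⁻¹ ⨾ (¡ ⊕₁ ¡))
    Δ-uniform : ∀ {X Y} → Δ {X ⊕₀ Y} ≈ ((Δ ⊕₁ Δ) ⨾ mid⊕)
    !-uniform : ∀ {X Y} → ! {X ⊕₀ Y} ≈ ((! ⊕₁ !) ⨾ λ⊕)

    ∇-hom : ∀ {X Y} (f : X ⇒ Y) → ((f ⊕₁ f) ⨾ ∇) ≈ (∇ ⨾ f)
    ¡-hom : ∀ {X Y} (f : X ⇒ Y) → (¡ ⨾ f) ≈ ¡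
    Δ-hom : ∀ {X Y} (f : X ⇒ Y) → (f ⨾ Δ) ≈ (Δ ⨾ (f ⊕₁ f))
    !-hom : ∀ {X Y} (f : X ⇒ Y) → (f ⨾ !) ≈ !

    ∇Δ-≥ : ∀ {X} → id {X ⊕₀ X} ≤ (∇ ⨾ Δ)
    Δ∇-≤ : ∀ {X} → (Δ ⨾ ∇) ≤ id {X}
    ¡!-≥ : ∀ {X} → id {𝟘} ≤ (¡ {X} ⨾ !)
    !¡-≤ : ∀ {X} → (! ⨾ ¡) ≤ id {X}

    tr : ∀ {S X Y} → (S ⊕₀ X) ⇒ (S ⊕₀ Y) → X ⇒ Y

    tr-tightening : ∀ {S X X' Y Y'} (f : X' ⇒ X) (g : (S ⊕₀ X) ⇒ (S ⊕₀ Y)) (h : Y ⇒ Y') →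
                    tr {S} ((id ⊕₁ f) ⨾ (g ⨾ (id ⊕₁ h))) ≈ (f ⨾ (tr g ⨾ h))
    tr-strength   : ∀ {S X Y Z W} (f : (S ⊕₀ X) ⇒ (S ⊕₀ Y)) (g : Z ⇒ W) →
                    (tr f ⊕₁ g) ≈ tr {S} (α⊕ ⨾ ((f ⊕₁ g) ⨾ α⊕⁻¹))
    tr-joining    : ∀ {S T X Y} (f : ((S ⊕₀ T) ⊕₀ X) ⇒ ((S ⊕₀ T) ⊕₀ Y)) →
                    tr {S ⊕₀ T} f ≈ tr {T} (tr {S} (α⊕ ⨾ (f ⨾ α⊕⁻¹)))
    tr-vanishing  : ∀ {X Y} (f : (𝟘 ⊕₀ X) ⇒ (𝟘 ⊕₀ Y)) →
                    tr {𝟘} f ≈ (λ⊕⁻¹ ⨾ (f ⨾ λ⊕))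
    tr-sliding    : ∀ {S T X Y} (f : (S ⊕₀ X) ⇒ (T ⊕₀ Y)) (r : T ⇒ S) →
                    tr {S} (f ⨾ (r ⊕₁ id)) ≈ tr {T} ((r ⊕₁ id) ⨾ f)
    tr-yanking    : ∀ {X} → tr {X} (σ⊕ {X} {X}) ≈ id

    AU1 : ∀ {S T X Y} {f : (S ⊕₀ X) ⇒ (S ⊕₀ Y)} {g : (T ⊕₀ X) ⇒ (T ⊕₀ Y)} (r : S ⇒ T) →
          (f ⨾ (r ⊕₁ id)) ≤ ((r ⊕₁ id) ⨾ g) → tr f ≤ tr g
    AU2 : ∀ {S T X Y} {f : (S ⊕₀ X) ⇒ (S ⊕₀ Y)} {g : (T ⊕₀ X) ⇒ (T ⊕₀ Y)} (r : T ⇒ S) →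
          ((r ⊕₁ id) ⨾ f) ≤ (g ⨾ (r ⊕₁ id)) → tr f ≤ tr g
    AT1 : ∀ {X} → tr {X} (∇ ⨾ Δ) ≤ id

  _* : ∀ {X} → X ⇒ X → X ⇒ X
  _* {X} f = tr {X} (∇ ⨾ (Δ ⨾ (f ⊕₁ id {X})))

{-# OPTIONS --safe #-}
module Submission where

open import Defs
open import Level using (Level)
open import Data.Product using (_,_; proj₁; proj₂)
open import Relation.Binary.Bundles using (Preorder)
import Relation.Binary.Reasoning.Preorder as PreorderReasoning

-- In Kleene algebra terms, f * is the least c with id ≤ c and c ⨾ f ≤ c:
-- leastness is AU2 (simulating the star's loop by c) followed by AT1, while
-- id ≤ f * comes from AU1 and f * ⨾ f ≤ f * from re-tracing the loop over a
-- doubled state wire.  Since ⊗ is a monotone functor, a * ⊗ b * inherits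
-- both closure properties with respect to a ⊗ b.

module Properties {o ℓ r : Level} (C : KleeneRigCategory o ℓ r) where
  open KleeneRigCategory C
  private
    module ⊕ = SymMonStr ⊕-str

  ≈-refl : ∀ {X Y} {f : X ⇒ Y} → f ≈ f
  ≈-refl = ≤-refl , ≤-refl

  ≈-sym : ∀ {X Y} {f g : X ⇒ Y} → f ≈ g → g ≈ f
  ≈-sym (f≤g , g≤f) = g≤f , f≤g

  ≈-trans : ∀ {X Y} {f g h : X ⇒ Y} → f ≈ g → g ≈ h → f ≈ h
  ≈-trans (f≤g , g≤f) (g≤h , h≤g) = ≤-trans f≤g g≤h , ≤-trans h≤g g≤f

  ≈⇒≤ : ∀ {X Y} {f g : X ⇒ Y} → f ≈ g → f ≤ g
  ≈⇒≤ = proj₁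

  hom-preorder : Obj → Obj → Preorder ℓ r r
  hom-preorder X Y = record
    { Carrier    = X ⇒ Y
    ; _≈_        = _≈_
    ; _≲_        = _≤_
    ; isPreorder = record
      { isEquivalence = record { refl = ≈-refl ; sym = ≈-sym ; trans = ≈-trans }
      ; reflexive     = ≈⇒≤
      ; trans         = ≤-trans
      }
    }

  private
    module HomReasoning {X Y : Obj} = PreorderReasoning (hom-preorder X Y)
  open HomReasoning

  ⨾-cong : ∀ {X Y Z} {f f' : X ⇒ Y} {g g' : Y ⇒ Z} → f ≈ f' → g ≈ g' → (f ⨾ g) ≈ (f' ⨾ g')
  ⨾-cong (f≤f' , f'≤f) (g≤g' , g'≤g) = ⨾-mono f≤f' g≤g' , ⨾-mono f'≤f g'≤g

  ⨾-congˡ : ∀ {X Y Z} (f : X ⇒ Y) {g g' : Y ⇒ Z} → g ≈ g' → (f ⨾ g) ≈ (f ⨾ g')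
  ⨾-congˡ f = ⨾-cong ≈-refl

  ⨾-congʳ : ∀ {X Y Z} {f f' : X ⇒ Y} (g : Y ⇒ Z) → f ≈ f' → (f ⨾ g) ≈ (f' ⨾ g)
  ⨾-congʳ g f≈f' = ⨾-cong f≈f' ≈-refl

  ⊕-cong : ∀ {X Y Z W} {f f' : X ⇒ Y} {g g' : Z ⇒ W} → f ≈ f' → g ≈ g' → (f ⊕₁ g) ≈ (f' ⊕₁ g')
  ⊕-cong (f≤f' , f'≤f) (g≤g' , g'≤g) = ⊕.∙-mono f≤f' g≤g' , ⊕.∙-mono f'≤f g'≤g

  cancelˡ : ∀ {X Y Z} {u : X ⇒ Y} {v : Y ⇒ X} (g : X ⇒ Z) → (u ⨾ v) ≈ id → (u ⨾ (v ⨾ g)) ≈ g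
  cancelˡ {u = u} {v} g u⨾v≈id = begin-equality
    u ⨾ (v ⨾ g)  ≈⟨ ⨾-assoc u v g ⟨
    (u ⨾ v) ⨾ g  ≈⟨ ⨾-congʳ g u⨾v≈id ⟩
    id ⨾ g       ≈⟨ idˡ g ⟩
    g            ∎

  ⊕-inverse : ∀ {X Y X' Y'} {u : X ⇒ Y} {v : Y ⇒ X} {u' : X' ⇒ Y'} {v' : Y' ⇒ X'} →
              (u ⨾ v) ≈ id → (u' ⨾ v') ≈ id → ((u ⊕₁ u') ⨾ (v ⊕₁ v')) ≈ id
  ⊕-inverse u⨾v≈id u'⨾v'≈id =
    ≈-trans (⊕.∙-comp _ _ _ _) (≈-trans (⊕-cong u⨾v≈id u'⨾v'≈id) ⊕.∙-id)

  ⊕-decompose : ∀ {X Y Z W} (f : X ⇒ Y) (g : Z ⇒ W) → (f ⊕₁ g) ≈ ((f ⊕₁ id) ⨾ (id ⊕₁ g))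
  ⊕-decompose f g = ≈-sym (≈-trans (⊕.∙-comp f id id g) (⊕-cong (idʳ f) (idˡ g)))

  ⊕-decompose′ : ∀ {X Y Z W} (f : X ⇒ Y) (g : Z ⇒ W) → (f ⊕₁ g) ≈ ((id ⊕₁ g) ⨾ (f ⊕₁ id))
  ⊕-decompose′ f g = ≈-sym (≈-trans (⊕.∙-comp id f g id) (⊕-cong (idˡ f) (idʳ g)))

  ⊕id-⨾ : ∀ {X Y Z W} (f : X ⇒ Y) (g : Y ⇒ Z) → ((f ⨾ g) ⊕₁ id {W}) ≈ ((f ⊕₁ id) ⨾ (g ⊕₁ id))
  ⊕id-⨾ f g = ≈-sym (≈-trans (⊕.∙-comp f g id id) (⊕-cong ≈-refl (idˡ id)))

  id⊕-⨾ : ∀ {X Y Z W} (f : X ⇒ Y) (g : Y ⇒ Z) → (id {W} ⊕₁ (f ⨾ g)) ≈ ((id ⊕₁ f) ⨾ (id ⊕₁ g))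
  id⊕-⨾ f g = ≈-sym (≈-trans (⊕.∙-comp id id f g) (⊕-cong (idˡ id) ≈-refl))

  -- The right-hand side followed by (id ⊕ σ) ⨾ α ⨾ (σ ⊕ id) collapses to α, and
  -- by the hexagon axiom that factor equals the invertible α ⨾ σ ⨾ α.
  σ⨾α⁻¹-hexagon : ∀ {A B C} →
    (σ⊕ {A} {B ⊕₀ C} ⨾ α⊕⁻¹) ≈ (α⊕ ⨾ ((σ⊕ ⊕₁ id) ⨾ (α⊕⁻¹ ⨾ (id ⊕₁ σ⊕))))
  σ⨾α⁻¹-hexagon {A} {B} {C} = ≈-sym (begin-equality
    E                                  ≈⟨ idʳ E ⟨
    E ⨾ id                             ≈⟨ ⨾-congˡ E hexagon-inverse ⟨
    E ⨾ (hexagon-rhs ⨾ hexagon-lhs⁻¹)  ≈⟨ ⨾-assoc _ _ _ ⟨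
    (E ⨾ hexagon-rhs) ⨾ hexagon-lhs⁻¹  ≈⟨ ⨾-congʳ hexagon-lhs⁻¹ E⨾hexagon-rhs ⟩
    α⊕ ⨾ hexagon-lhs⁻¹                 ≈⟨ cancelˡ _ ⊕.assoc-iso₁ ⟩
    σ⊕ ⨾ α⊕⁻¹                          ∎)
    where
    E : (A ⊕₀ (B ⊕₀ C)) ⇒ (B ⊕₀ (C ⊕₀ A))
    E = α⊕ ⨾ ((σ⊕ ⊕₁ id) ⨾ (α⊕⁻¹ ⨾ (id ⊕₁ σ⊕)))

    hexagon-rhs : (B ⊕₀ (C ⊕₀ A)) ⇒ ((A ⊕₀ B) ⊕₀ C)
    hexagon-rhs = (id ⊕₁ σ⊕) ⨾ (α⊕ ⨾ (σ⊕ ⊕₁ id))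

    hexagon-lhs⁻¹ : ((A ⊕₀ B) ⊕₀ C) ⇒ (B ⊕₀ (C ⊕₀ A))
    hexagon-lhs⁻¹ = α⊕⁻¹ ⨾ (σ⊕ ⨾ α⊕⁻¹)

    hexagon-inverse : (hexagon-rhs ⨾ hexagon-lhs⁻¹) ≈ id
    hexagon-inverse = begin-equality
      hexagon-rhs ⨾ hexagon-lhs⁻¹                   ≈⟨ ⨾-congʳ hexagon-lhs⁻¹ ⊕.hexagon ⟨
      (α⊕ ⨾ (σ⊕ ⨾ α⊕)) ⨾ (α⊕⁻¹ ⨾ (σ⊕ ⨾ α⊕⁻¹))       ≈⟨ ⨾-assoc _ _ _ ⟩
      α⊕ ⨾ ((σ⊕ ⨾ α⊕) ⨾ (α⊕⁻¹ ⨾ (σ⊕ ⨾ α⊕⁻¹)))       ≈⟨ ⨾-congˡ α⊕ (⨾-assoc _ _ _) ⟩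
      α⊕ ⨾ (σ⊕ ⨾ (α⊕ ⨾ (α⊕⁻¹ ⨾ (σ⊕ ⨾ α⊕⁻¹))))       ≈⟨ ⨾-congˡ α⊕ (⨾-congˡ σ⊕ (cancelˡ _ ⊕.assoc-iso₁)) ⟩
      α⊕ ⨾ (σ⊕ ⨾ (σ⊕ ⨾ α⊕⁻¹))                       ≈⟨ ⨾-congˡ α⊕ (cancelˡ _ ⊕.sym-invol) ⟩
      α⊕ ⨾ α⊕⁻¹                                     ≈⟨ ⊕.assoc-iso₁ ⟩
      id                                            ∎

    E⨾hexagon-rhs : (E ⨾ hexagon-rhs) ≈ α⊕
    E⨾hexagon-rhs = begin-equality
      E ⨾ hexagon-rhs
        ≈⟨ ⨾-assoc _ _ _ ⟩
      α⊕ ⨾ (((σ⊕ ⊕₁ id) ⨾ (α⊕⁻¹ ⨾ (id ⊕₁ σ⊕))) ⨾ hexagon-rhs)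
        ≈⟨ ⨾-congˡ α⊕ (⨾-assoc _ _ _) ⟩
      α⊕ ⨾ ((σ⊕ ⊕₁ id) ⨾ ((α⊕⁻¹ ⨾ (id ⊕₁ σ⊕)) ⨾ hexagon-rhs))
        ≈⟨ ⨾-congˡ α⊕ (⨾-congˡ _ (⨾-assoc _ _ _)) ⟩
      α⊕ ⨾ ((σ⊕ ⊕₁ id) ⨾ (α⊕⁻¹ ⨾ ((id ⊕₁ σ⊕) ⨾ ((id ⊕₁ σ⊕) ⨾ (α⊕ ⨾ (σ⊕ ⊕₁ id))))))
        ≈⟨ ⨾-congˡ α⊕ (⨾-congˡ _ (⨾-congˡ α⊕⁻¹ (cancelˡ _ (⊕-inverse (idˡ id) ⊕.sym-invol)))) ⟩
      α⊕ ⨾ ((σ⊕ ⊕₁ id) ⨾ (α⊕⁻¹ ⨾ (α⊕ ⨾ (σ⊕ ⊕₁ id))))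
        ≈⟨ ⨾-congˡ α⊕ (⨾-congˡ _ (cancelˡ _ ⊕.assoc-iso₂)) ⟩
      α⊕ ⨾ ((σ⊕ ⊕₁ id) ⨾ (σ⊕ ⊕₁ id))
        ≈⟨ ⨾-congˡ α⊕ (⊕-inverse ⊕.sym-invol (idˡ id)) ⟩
      α⊕ ⨾ id
        ≈⟨ idʳ α⊕ ⟩
      α⊕ ∎

  tr-mono : ∀ {S X Y} {f g : (S ⊕₀ X) ⇒ (S ⊕₀ Y)} → f ≤ g → tr f ≤ tr g
  tr-mono {f = f} {g} f≤g = AU1 id (begin
    f ⨾ (id ⊕₁ id)  ≈⟨ ⨾-congˡ f ⊕.∙-id ⟩
    f ⨾ id          ≈⟨ idʳ f ⟩
    f               ≲⟨ f≤g ⟩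
    g               ≈⟨ idˡ g ⟨
    id ⨾ g          ≈⟨ ⨾-congʳ g ⊕.∙-id ⟨
    (id ⊕₁ id) ⨾ g  ∎)

  tr-cong : ∀ {S X Y} {f g : (S ⊕₀ X) ⇒ (S ⊕₀ Y)} → f ≈ g → tr f ≈ tr g
  tr-cong (f≤g , g≤f) = tr-mono f≤g , tr-mono g≤f

  tr-tighteningˡ : ∀ {S X X' Y} (f : X' ⇒ X) (g : (S ⊕₀ X) ⇒ (S ⊕₀ Y)) →
                   tr {S} ((id ⊕₁ f) ⨾ g) ≈ (f ⨾ tr g)
  tr-tighteningˡ f g = begin-equality
    tr ((id ⊕₁ f) ⨾ g)                 ≈⟨ tr-cong (⨾-congˡ _ (≈-trans (⨾-congˡ g ⊕.∙-id) (idʳ g))) ⟨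
    tr ((id ⊕₁ f) ⨾ (g ⨾ (id ⊕₁ id)))  ≈⟨ tr-tightening f g id ⟩
    f ⨾ (tr g ⨾ id)                    ≈⟨ ⨾-congˡ f (idʳ (tr g)) ⟩
    f ⨾ tr g                           ∎

  tr-tighteningʳ : ∀ {S X Y Y'} (g : (S ⊕₀ X) ⇒ (S ⊕₀ Y)) (h : Y ⇒ Y') →
                   tr {S} (g ⨾ (id ⊕₁ h)) ≈ (tr g ⨾ h)
  tr-tighteningʳ g h = begin-equality
    tr (g ⨾ (id ⊕₁ h))                 ≈⟨ tr-cong (≈-trans (⨾-congʳ _ ⊕.∙-id) (idˡ _)) ⟨
    tr ((id ⊕₁ id) ⨾ (g ⨾ (id ⊕₁ h)))  ≈⟨ tr-tightening id g h ⟩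
    id ⨾ (tr g ⨾ h)                    ≈⟨ idˡ (tr g ⨾ h) ⟩
    tr g ⨾ h                           ∎

  tr-σ⨾α⁻¹ : ∀ {X Y} → tr {X} (σ⊕ {X} {X ⊕₀ Y} ⨾ α⊕⁻¹) ≈ σ⊕ {X} {Y}
  tr-σ⨾α⁻¹ = begin-equality
    tr (σ⊕ ⨾ α⊕⁻¹)                                     ≈⟨ tr-cong σ⨾α⁻¹-hexagon ⟩
    tr (α⊕ ⨾ ((σ⊕ ⊕₁ id) ⨾ (α⊕⁻¹ ⨾ (id ⊕₁ σ⊕))))       ≈⟨ tr-cong (⨾-congˡ α⊕ (⨾-assoc _ _ _)) ⟨
    tr (α⊕ ⨾ (((σ⊕ ⊕₁ id) ⨾ α⊕⁻¹) ⨾ (id ⊕₁ σ⊕)))       ≈⟨ tr-cong (⨾-assoc _ _ _) ⟨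
    tr ((α⊕ ⨾ ((σ⊕ ⊕₁ id) ⨾ α⊕⁻¹)) ⨾ (id ⊕₁ σ⊕))       ≈⟨ tr-tighteningʳ _ σ⊕ ⟩
    tr (α⊕ ⨾ ((σ⊕ ⊕₁ id) ⨾ α⊕⁻¹)) ⨾ σ⊕                 ≈⟨ ⨾-congʳ σ⊕ (tr-strength σ⊕ id) ⟨
    (tr σ⊕ ⊕₁ id) ⨾ σ⊕                                 ≈⟨ ⨾-congʳ σ⊕ (≈-trans (⊕-cong tr-yanking ≈-refl) ⊕.∙-id) ⟩
    id ⨾ σ⊕                                            ≈⟨ idˡ σ⊕ ⟩
    σ⊕                                                 ∎

  -- The σ is absorbed as a second feedback wire (generalised yanking), which
  -- joining then merges with the first.
  tr-⨾σ : ∀ {S T X} (h : (S ⊕₀ X) ⇒ (T ⊕₀ S)) →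
          tr {S} (h ⨾ σ⊕) ≈ tr {T ⊕₀ S} (α⊕⁻¹ ⨾ ((id ⊕₁ h) ⨾ σ⊕))
  tr-⨾σ h = begin-equality
    tr (h ⨾ σ⊕)                                          ≈⟨ tr-cong (⨾-congˡ h tr-σ⨾α⁻¹) ⟨
    tr (h ⨾ tr (σ⊕ ⨾ α⊕⁻¹))                              ≈⟨ tr-cong (tr-tighteningˡ h _) ⟨
    tr (tr ((id ⊕₁ h) ⨾ (σ⊕ ⨾ α⊕⁻¹)))                    ≈⟨ tr-cong (tr-cong reassociate) ⟨
    tr (tr (α⊕ ⨾ ((α⊕⁻¹ ⨾ ((id ⊕₁ h) ⨾ σ⊕)) ⨾ α⊕⁻¹)))    ≈⟨ tr-joining _ ⟨
    tr (α⊕⁻¹ ⨾ ((id ⊕₁ h) ⨾ σ⊕))                         ∎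
    where
    reassociate : (α⊕ ⨾ ((α⊕⁻¹ ⨾ ((id ⊕₁ h) ⨾ σ⊕)) ⨾ α⊕⁻¹)) ≈ ((id ⊕₁ h) ⨾ (σ⊕ ⨾ α⊕⁻¹))
    reassociate = begin-equality
      α⊕ ⨾ ((α⊕⁻¹ ⨾ ((id ⊕₁ h) ⨾ σ⊕)) ⨾ α⊕⁻¹)  ≈⟨ ⨾-congˡ α⊕ (⨾-assoc _ _ _) ⟩
      α⊕ ⨾ (α⊕⁻¹ ⨾ (((id ⊕₁ h) ⨾ σ⊕) ⨾ α⊕⁻¹))  ≈⟨ cancelˡ _ ⊕.assoc-iso₁ ⟩
      ((id ⊕₁ h) ⨾ σ⊕) ⨾ α⊕⁻¹                  ≈⟨ ⨾-assoc _ _ _ ⟩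
      (id ⊕₁ h) ⨾ (σ⊕ ⨾ α⊕⁻¹)                  ∎

  ∇-unitˡ′ : ∀ {X} → ((¡ ⊕₁ id) ⨾ ∇) ≈ λ⊕ {X}
  ∇-unitˡ′ = begin-equality
    (¡ ⊕₁ id) ⨾ ∇                  ≈⟨ cancelˡ _ ⊕.lunit-iso₁ ⟨
    λ⊕ ⨾ (λ⊕⁻¹ ⨾ ((¡ ⊕₁ id) ⨾ ∇))  ≈⟨ ⨾-congˡ λ⊕ ∇-unit ⟩
    λ⊕ ⨾ id                        ≈⟨ idʳ λ⊕ ⟩
    λ⊕                             ∎

  Δ-counitˡ′ : ∀ {X} → (Δ ⨾ (! ⊕₁ id)) ≈ λ⊕⁻¹ {X}
  Δ-counitˡ′ = begin-equality
    Δ ⨾ (! ⊕₁ id)                  ≈⟨ idʳ _ ⟨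
    (Δ ⨾ (! ⊕₁ id)) ⨾ id           ≈⟨ ⨾-congˡ _ ⊕.lunit-iso₁ ⟨
    (Δ ⨾ (! ⊕₁ id)) ⨾ (λ⊕ ⨾ λ⊕⁻¹)  ≈⟨ ⨾-assoc _ _ _ ⟨
    ((Δ ⨾ (! ⊕₁ id)) ⨾ λ⊕) ⨾ λ⊕⁻¹  ≈⟨ ⨾-congʳ λ⊕⁻¹ (≈-trans (⨾-assoc _ _ _) Δ-unit) ⟩
    id ⨾ λ⊕⁻¹                      ≈⟨ idˡ λ⊕⁻¹ ⟩
    λ⊕⁻¹                           ∎

  !⨾¡≤ : ∀ {X Y} (f : X ⇒ Y) → (! ⨾ ¡) ≤ f
  !⨾¡≤ f = begin
    ! ⨾ ¡        ≈⟨ ⨾-congˡ ! (¡-hom f) ⟨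
    ! ⨾ (¡ ⨾ f)  ≈⟨ ⨾-assoc _ _ _ ⟨
    (! ⨾ ¡) ⨾ f  ≲⟨ ⨾-mono !¡-≤ ≤-refl ⟩
    id ⨾ f       ≈⟨ idˡ f ⟩
    f            ∎

  ∇⨾Δ-natural : ∀ {X Y} (f : X ⇒ Y) → ((f ⊕₁ f) ⨾ (∇ ⨾ Δ)) ≈ ((∇ ⨾ Δ) ⨾ (f ⊕₁ f))
  ∇⨾Δ-natural f = begin-equality
    (f ⊕₁ f) ⨾ (∇ ⨾ Δ)  ≈⟨ ⨾-assoc _ _ _ ⟨
    ((f ⊕₁ f) ⨾ ∇) ⨾ Δ  ≈⟨ ⨾-congʳ Δ (∇-hom f) ⟩
    (∇ ⨾ f) ⨾ Δ         ≈⟨ ⨾-assoc _ _ _ ⟩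
    ∇ ⨾ (f ⨾ Δ)         ≈⟨ ⨾-congˡ ∇ (Δ-hom f) ⟩
    ∇ ⨾ (Δ ⨾ (f ⊕₁ f))  ≈⟨ ⨾-assoc _ _ _ ⟨
    (∇ ⨾ Δ) ⨾ (f ⊕₁ f)  ∎

  frobenius-≤ : ∀ {X} → ((Δ ⊕₁ id) ⨾ (α⊕⁻¹ ⨾ (id ⊕₁ ∇))) ≤ (∇ ⨾ Δ {X})
  frobenius-≤ {X} = begin
    F                  ≈⟨ idʳ F ⟨
    F ⨾ id             ≲⟨ ⨾-mono ≤-refl ∇Δ-≥ ⟩
    F ⨾ (∇ ⨾ Δ)        ≈⟨ ⨾-assoc _ _ _ ⟨
    (F ⨾ ∇) ⨾ Δ        ≲⟨ ⨾-mono F⨾∇≤∇ ≤-refl ⟩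
    ∇ ⨾ Δ              ∎
    where
    F : (X ⊕₀ X) ⇒ (X ⊕₀ X)
    F = (Δ ⊕₁ id) ⨾ (α⊕⁻¹ ⨾ (id ⊕₁ ∇))

    F⨾∇≤∇ : (F ⨾ ∇) ≤ ∇
    F⨾∇≤∇ = begin
      F ⨾ ∇                                      ≈⟨ ⨾-assoc _ _ _ ⟩
      (Δ ⊕₁ id) ⨾ ((α⊕⁻¹ ⨾ (id ⊕₁ ∇)) ⨾ ∇)       ≈⟨ ⨾-congˡ _ (⨾-assoc _ _ _) ⟩
      (Δ ⊕₁ id) ⨾ (α⊕⁻¹ ⨾ ((id ⊕₁ ∇) ⨾ ∇))       ≈⟨ ⨾-congˡ _ (⨾-congˡ α⊕⁻¹ ∇-assoc) ⟨
      (Δ ⊕₁ id) ⨾ (α⊕⁻¹ ⨾ (α⊕ ⨾ ((∇ ⊕₁ id) ⨾ ∇))) ≈⟨ ⨾-congˡ _ (cancelˡ _ ⊕.assoc-iso₂) ⟩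
      (Δ ⊕₁ id) ⨾ ((∇ ⊕₁ id) ⨾ ∇)                 ≈⟨ ⨾-assoc _ _ _ ⟨
      ((Δ ⊕₁ id) ⨾ (∇ ⊕₁ id)) ⨾ ∇                 ≈⟨ ⨾-congʳ ∇ (⊕id-⨾ Δ ∇) ⟨
      ((Δ ⨾ ∇) ⊕₁ id) ⨾ ∇                         ≲⟨ ⨾-mono (⊕.∙-mono Δ∇-≤ ≤-refl) ≤-refl ⟩
      (id ⊕₁ id) ⨾ ∇                              ≈⟨ ⨾-congʳ ∇ ⊕.∙-id ⟩
      id ⨾ ∇                                      ≈⟨ idˡ ∇ ⟩
      ∇                                           ∎

  *-reflexive : ∀ {X} (f : X ⇒ X) → id ≤ (f *)
  *-reflexive f = ≤-trans id≤tr-id (AU1 ¡ simulation)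
    where
    id≤tr-id : ∀ {X} → id {X} ≤ tr {𝟘} id
    id≤tr-id = begin
      id               ≈⟨ ⊕.lunit-iso₂ ⟨
      λ⊕⁻¹ ⨾ λ⊕        ≈⟨ ⨾-congˡ λ⊕⁻¹ (idˡ λ⊕) ⟨
      λ⊕⁻¹ ⨾ (id ⨾ λ⊕) ≈⟨ tr-vanishing id ⟨
      tr id            ∎

    simulation : (id ⨾ (¡ ⊕₁ id)) ≤ ((¡ ⊕₁ id) ⨾ (∇ ⨾ (Δ ⨾ (f ⊕₁ id))))
    simulation = begin
      id ⨾ (¡ ⊕₁ id)                       ≈⟨ idˡ _ ⟩
      ¡ ⊕₁ id                              ≈⟨ cancelˡ _ ⊕.lunit-iso₁ ⟨
      λ⊕ ⨾ (λ⊕⁻¹ ⨾ (¡ ⊕₁ id))              ≈⟨ ⨾-congˡ λ⊕ (⨾-congʳ _ Δ-counitˡ′) ⟨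
      λ⊕ ⨾ ((Δ ⨾ (! ⊕₁ id)) ⨾ (¡ ⊕₁ id))   ≈⟨ ⨾-congˡ λ⊕ (⨾-assoc _ _ _) ⟩
      λ⊕ ⨾ (Δ ⨾ ((! ⊕₁ id) ⨾ (¡ ⊕₁ id)))   ≈⟨ ⨾-congˡ λ⊕ (⨾-congˡ Δ (⊕id-⨾ ! ¡)) ⟨
      λ⊕ ⨾ (Δ ⨾ ((! ⨾ ¡) ⊕₁ id))           ≲⟨ ⨾-mono ≤-refl (⨾-mono ≤-refl (⊕.∙-mono (!⨾¡≤ f) ≤-refl)) ⟩
      λ⊕ ⨾ (Δ ⨾ (f ⊕₁ id))                 ≈⟨ ⨾-congʳ _ ∇-unitˡ′ ⟨
      ((¡ ⊕₁ id) ⨾ ∇) ⨾ (Δ ⨾ (f ⊕₁ id))    ≈⟨ ⨾-assoc _ _ _ ⟩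
      (¡ ⊕₁ id) ⨾ (∇ ⨾ (Δ ⨾ (f ⊕₁ id)))    ∎

  *-induction : ∀ {X} (f c : X ⇒ X) → id ≤ c → (c ⨾ f) ≤ c → (f *) ≤ c
  *-induction f c id≤c c⨾f≤c = ≤-trans (AU2 c simulation) tr-loop≤c
    where
    tr-loop≤c : tr (∇ ⨾ (Δ ⨾ (id ⊕₁ c))) ≤ c
    tr-loop≤c = begin
      tr (∇ ⨾ (Δ ⨾ (id ⊕₁ c)))  ≈⟨ tr-cong (⨾-assoc _ _ _) ⟨
      tr ((∇ ⨾ Δ) ⨾ (id ⊕₁ c))  ≈⟨ tr-tighteningʳ _ c ⟩
      tr (∇ ⨾ Δ) ⨾ c            ≲⟨ ⨾-mono AT1 ≤-refl ⟩
      id ⨾ c                    ≈⟨ idˡ c ⟩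
      c                         ∎

    simulation : ((c ⊕₁ id) ⨾ (∇ ⨾ (Δ ⨾ (f ⊕₁ id)))) ≤ ((∇ ⨾ (Δ ⨾ (id ⊕₁ c))) ⨾ (c ⊕₁ id))
    simulation = begin
      (c ⊕₁ id) ⨾ (∇ ⨾ (Δ ⨾ (f ⊕₁ id)))  ≲⟨ ⨾-mono (⊕.∙-mono ≤-refl id≤c) ≤-refl ⟩
      (c ⊕₁ c) ⨾ (∇ ⨾ (Δ ⨾ (f ⊕₁ id)))   ≈⟨ ⨾-congˡ _ (⨾-assoc _ _ _) ⟨
      (c ⊕₁ c) ⨾ ((∇ ⨾ Δ) ⨾ (f ⊕₁ id))   ≈⟨ ⨾-assoc _ _ _ ⟨
      ((c ⊕₁ c) ⨾ (∇ ⨾ Δ)) ⨾ (f ⊕₁ id)   ≈⟨ ⨾-congʳ _ (∇⨾Δ-natural c) ⟩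
      ((∇ ⨾ Δ) ⨾ (c ⊕₁ c)) ⨾ (f ⊕₁ id)   ≈⟨ ⨾-assoc _ _ _ ⟩
      (∇ ⨾ Δ) ⨾ ((c ⊕₁ c) ⨾ (f ⊕₁ id))   ≈⟨ ⨾-congˡ _ (⊕.∙-comp c f c id) ⟩
      (∇ ⨾ Δ) ⨾ ((c ⨾ f) ⊕₁ (c ⨾ id))    ≲⟨ ⨾-mono ≤-refl (⊕.∙-mono c⨾f≤c (≈⇒≤ (idʳ c))) ⟩
      (∇ ⨾ Δ) ⨾ (c ⊕₁ c)                 ≈⟨ ⨾-congˡ _ (⊕-decompose′ c c) ⟩
      (∇ ⨾ Δ) ⨾ ((id ⊕₁ c) ⨾ (c ⊕₁ id))  ≈⟨ ⨾-assoc _ _ _ ⟨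
      ((∇ ⨾ Δ) ⨾ (id ⊕₁ c)) ⨾ (c ⊕₁ id)  ≈⟨ ⨾-congʳ _ (⨾-assoc _ _ _) ⟩
      (∇ ⨾ (Δ ⨾ (id ⊕₁ c))) ⨾ (c ⊕₁ id)  ∎

  -- Both outputs of ∇ ⨾ f ⨾ Δ are equal, so its trace can be retaken over X ⊕ X,
  -- and that loop is simulated by the star's loop along Δ (AU2).
  *-unfoldʳ : ∀ {X} (f : X ⇒ X) → ((f *) ⨾ f) ≤ (f *)
  *-unfoldʳ {X} f = begin
    (f *) ⨾ f                                   ≈⟨ tr-tighteningʳ loop f ⟨
    tr (loop ⨾ (id ⊕₁ f))                       ≈⟨ tr-cong loop⨾id⊕f ⟩
    tr (∇ ⨾ (f ⨾ Δ))                            ≈⟨ tr-cong ∇⨾f⨾Δ-symmetric ⟨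
    tr ((∇ ⨾ (f ⨾ Δ)) ⨾ σ⊕)                     ≈⟨ tr-⨾σ (∇ ⨾ (f ⨾ Δ)) ⟩
    tr (α⊕⁻¹ ⨾ ((id ⊕₁ (∇ ⨾ (f ⨾ Δ))) ⨾ σ⊕))    ≲⟨ AU2 Δ simulation ⟩
    f *                                         ∎
    where
    loop : (X ⊕₀ X) ⇒ (X ⊕₀ X)
    loop = ∇ ⨾ (Δ ⨾ (f ⊕₁ id))

    loop⨾id⊕f : (loop ⨾ (id ⊕₁ f)) ≈ (∇ ⨾ (f ⨾ Δ))
    loop⨾id⊕f = begin-equality
      loop ⨾ (id ⊕₁ f)                    ≈⟨ ⨾-assoc _ _ _ ⟩
      ∇ ⨾ ((Δ ⨾ (f ⊕₁ id)) ⨾ (id ⊕₁ f))   ≈⟨ ⨾-congˡ ∇ (⨾-assoc _ _ _) ⟩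
      ∇ ⨾ (Δ ⨾ ((f ⊕₁ id) ⨾ (id ⊕₁ f)))   ≈⟨ ⨾-congˡ ∇ (⨾-congˡ Δ (⊕-decompose f f)) ⟨
      ∇ ⨾ (Δ ⨾ (f ⊕₁ f))                  ≈⟨ ⨾-congˡ ∇ (Δ-hom f) ⟨
      ∇ ⨾ (f ⨾ Δ)                         ∎

    ∇⨾f⨾Δ-symmetric : ((∇ ⨾ (f ⨾ Δ)) ⨾ σ⊕) ≈ (∇ ⨾ (f ⨾ Δ))
    ∇⨾f⨾Δ-symmetric = begin-equality
      (∇ ⨾ (f ⨾ Δ)) ⨾ σ⊕   ≈⟨ ⨾-assoc _ _ _ ⟩
      ∇ ⨾ ((f ⨾ Δ) ⨾ σ⊕)   ≈⟨ ⨾-congˡ ∇ (⨾-assoc _ _ _) ⟩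
      ∇ ⨾ (f ⨾ (Δ ⨾ σ⊕))   ≈⟨ ⨾-congˡ ∇ (⨾-congˡ f Δ-comm) ⟩
      ∇ ⨾ (f ⨾ Δ)          ∎

    simulation : ((Δ ⊕₁ id) ⨾ (α⊕⁻¹ ⨾ ((id ⊕₁ (∇ ⨾ (f ⨾ Δ))) ⨾ σ⊕))) ≤ (loop ⨾ (Δ ⊕₁ id))
    simulation = begin
      (Δ ⊕₁ id) ⨾ (α⊕⁻¹ ⨾ ((id ⊕₁ (∇ ⨾ (f ⨾ Δ))) ⨾ σ⊕))
        ≈⟨ ⨾-congˡ _ (⨾-congˡ α⊕⁻¹ (⨾-congʳ σ⊕ (id⊕-⨾ ∇ (f ⨾ Δ)))) ⟩
      (Δ ⊕₁ id) ⨾ (α⊕⁻¹ ⨾ (((id ⊕₁ ∇) ⨾ (id ⊕₁ (f ⨾ Δ))) ⨾ σ⊕))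
        ≈⟨ ⨾-congˡ _ (≈-trans (⨾-congˡ α⊕⁻¹ (⨾-assoc _ _ _)) (≈-sym (⨾-assoc _ _ _))) ⟩
      (Δ ⊕₁ id) ⨾ ((α⊕⁻¹ ⨾ (id ⊕₁ ∇)) ⨾ ((id ⊕₁ (f ⨾ Δ)) ⨾ σ⊕))
        ≈⟨ ⨾-assoc _ _ _ ⟨
      ((Δ ⊕₁ id) ⨾ (α⊕⁻¹ ⨾ (id ⊕₁ ∇))) ⨾ ((id ⊕₁ (f ⨾ Δ)) ⨾ σ⊕)
        ≲⟨ ⨾-mono frobenius-≤ ≤-refl ⟩
      (∇ ⨾ Δ) ⨾ ((id ⊕₁ (f ⨾ Δ)) ⨾ σ⊕)
        ≈⟨ ⨾-congˡ _ (⊕.sym-nat id (f ⨾ Δ)) ⟩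
      (∇ ⨾ Δ) ⨾ (σ⊕ ⨾ ((f ⨾ Δ) ⊕₁ id))
        ≈⟨ ≈-trans (⨾-assoc _ _ _) (⨾-congˡ ∇ (≈-sym (⨾-assoc _ _ _))) ⟩
      ∇ ⨾ ((Δ ⨾ σ⊕) ⨾ ((f ⨾ Δ) ⊕₁ id))
        ≈⟨ ⨾-congˡ ∇ (⨾-congʳ _ Δ-comm) ⟩
      ∇ ⨾ (Δ ⨾ ((f ⨾ Δ) ⊕₁ id))
        ≈⟨ ⨾-congˡ ∇ (⨾-congˡ Δ (⊕id-⨾ f Δ)) ⟩
      ∇ ⨾ (Δ ⨾ ((f ⊕₁ id) ⨾ (Δ ⊕₁ id)))
        ≈⟨ ≈-trans (⨾-congˡ ∇ (≈-sym (⨾-assoc _ _ _))) (≈-sym (⨾-assoc _ _ _)) ⟩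
      loop ⨾ (Δ ⊕₁ id)
        ∎

proposition7p3 : ∀ {o ℓ r : Level} (C : KleeneRigCategory o ℓ r) →
    let open KleeneRigCategory C in
    ∀ {X Y : Obj} (a : X ⇒ X) (b : Y ⇒ Y) → ((a ⊗₁ b) *) ≤ ((a *) ⊗₁ (b *))
proposition7p3 C a b = *-induction (a ⊗₁ b) ((a *) ⊗₁ (b *)) id≤a*⊗b* a*⊗b*-closed
  where
  open KleeneRigCategory C
  open Properties C
  module ⊗ = SymMonStr ⊗-str

  id≤a*⊗b* : id ≤ ((a *) ⊗₁ (b *))
  id≤a*⊗b* = ≤-trans (proj₂ ⊗.∙-id) (⊗.∙-mono (*-reflexive a) (*-reflexive b))

  a*⊗b*-closed : (((a *) ⊗₁ (b *)) ⨾ (a ⊗₁ b)) ≤ ((a *) ⊗₁ (b *))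
  a*⊗b*-closed = ≤-trans (≈⇒≤ (⊗.∙-comp _ _ _ _)) (⊗.∙-mono (*-unfoldʳ a) (*-unfoldʳ b))
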